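{- Let $G$ be a connected finite simple graph with $n\geq 2$ vertices and $m$ edges. Let $e_1,\ldots,e_k$ (with $k=Z(L(G))$) and $e_{k+1},\ldots,e_m$ be an ordering of $E(G)$ witnessing the zero forcing number of $L(G)$, and let $P_1,\ldots,P_k$, $\ell$, $H$ and $\vec{H}$ be as defined in the context. Then the orientation $\vec{H}$ of $H$ is acyclic (contains no directed cycle).
   Context: All graphs are simple, finite, undirected; $[k]=\{1,\ldots,k\}$. The line graph $L(G)$ has vertex set $E(G)$, two vertices adjacent iff the corresponding edges of $G$ share an endpoint. The zero forcing number $Z(L(G))$ is the minimum $k$ such that there are vertices $e_1,\ldots,e_k$ of $L(G)$ and a linear order $e_{k+1},\ldots,e_m$ of the remaining vertices such that for every $j\in\{k+1,\ldots,m\}$ there is $i\in[j-1]$ with $e_j$ the unique neighbor of $e_i$ in $L(G)$ lying in $\{e_j,\ldots,e_m\}$ (one says $e_i$ forces $e_j$). Fix such an ordering with $k=Z(L(G))$ and, for each $j>k$, fix one such $i$ forcing $e_j$; each vertex then forces at most one vertex. This yields forcing chains $P_1,\ldots,P_k$, where $P_i: e_i^1e_i^2\ldots e_i^{m_i}$ with $e_i^1=e_i$, $e_i^j$ forces $e_i^{j+1}$ for $j\in[m_i-1]$, and $e_i^{m_i}$ forces nothing; every edge of $G$ lies on exactly one chain, and each $P_i$ is an induced path in $L(G)$. Order the chains so that $m_1,\ldots,m_\ell\geq 2$ and $m_{\ell+1}=\cdots=m_k=1$ for some $0\le \ell\le k$. Let $H$ be the spanning subgraph of $G$ with vertex set $V(G)$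 and edge set $\bigcup_{i=1}^{\ell}V(P_i)$. Let $\vec{H}$ be the orientation of $H$ in which an edge $e_i^j=uv$ ($i\in[\ell]$, $j\in[m_i]$) is oriented from $u$ to $v$ iff either ($j\geq 2$ and $e_i^{j-1}$ and $e_i^j$ share the vertex $u$) or ($j\leq m_i-1$ and $e_i^j$ and $e_i^{j+1}$ share the vertex $v$); since each $P_i$ is an induced path in $L(G)$, this orientation is well defined. -}

module Defs where

open import Data.Nat using (ℕ; _≤_; _<_)
open import Data.Fin using (Fin; toℕ; zero; suc; inject₁; fromℕ)
open import Data.Product using (_×_; _,_; proj₁; proj₂; ∃; ∃-syntax; Σ)
open import Data.Sum using (_⊎_)
open import Relation.Binary.PropositionalEquality using (_≡_; _≢_)
open import Relation.Nullary using (¬_)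
open import Function.Definitions using (Injective)
open import Function.Base using (id)

-- The indexing of the edges IS the zero-forcing ordering e_1,...,e_m of the
-- paper (edge index j : Fin m corresponds to e_{j+1}).
Ends : ℕ → ℕ → Set
Ends n m = Fin m → Fin n × Fin n

SameEnds : ∀ {n} → Fin n × Fin n → Fin n × Fin n → Set
SameEnds (a , b) (c , d) = (a ≡ c × b ≡ d) ⊎ (a ≡ d × b ≡ c)

IsSimple : ∀ {n m} → Ends n m → Set
IsSimple {n} {m} E =
  (∀ e → proj₁ (E e) ≢ proj₂ (E e)) × (∀ e f → SameEnds (E e) (E f) → e ≡ f)

Inc : ∀ {n m} → Ends n m → Fin n → Fin m → Set
Inc E v e = v ≡ proj₁ (E e) ⊎ v ≡ proj₂ (E e)

AdjG : ∀ {n m} → Ends n m → Fin n → Fin n → Set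
AdjG E u v = ∃[ e ] SameEnds (E e) (u , v)

data Reach {n m} (E : Ends n m) : Fin n → Fin n → Set where
  here : ∀ {u} → Reach E u u
  step : ∀ {u v w} → AdjG E u v → Reach E v w → Reach E u w

Connected : ∀ {n m} → Ends n m → Set
Connected {n} E = ∀ (u v : Fin n) → Reach E u v

LAdj : ∀ {n m} → Ends n m → Fin m → Fin m → Set
LAdj E e f = e ≢ f × ∃[ v ] (Inc E v e × Inc E v f)

-- Zero forcing in L(G) w.r.t. an ordering  ord : Fin m → Fin m  of E(G)
-- (position p holds the edge ord p).
Forces : ∀ {n m} → Ends n m → (Fin m → Fin m) → Fin m → Fin m → Set
Forces {n} {m} E ord i j =
  LAdj E (ord i) (ord j) ×
  (∀ (t : Fin m) → toℕ j ≤ toℕ t → LAdj E (ord i) (ord t) → t ≡ j)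

IsZFOrdering : ∀ {n m} → Ends n m → ℕ → (Fin m → Fin m) → Set
IsZFOrdering {n} {m} E k ord =
  ∀ (j : Fin m) → k ≤ toℕ j → ∃[ i ] (toℕ i < toℕ j × Forces E ord i j)

IsZeroForcingNumber : ∀ {n m} → Ends n m → ℕ → Set
IsZeroForcingNumber {n} {m} E k =
  (∃[ ord ] (Injective _≡_ _≡_ ord × IsZFOrdering E k ord)) ×
  (∀ (k' : ℕ) (ord : Fin m → Fin m) →
     Injective _≡_ _≡_ ord → IsZFOrdering E k' ord → k ≤ k')

-- Fixed choice of forcer  f j  for each position j ≥ k (values of f at
-- positions < k are irrelevant).  With the given ordering (= indexing):
ValidForcer : ∀ {n m} → Ends n m → ℕ → (Fin m → Fin m) → Set
ValidForcer {n} {m} E k f =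
  ∀ (j : Fin m) → k ≤ toℕ j → toℕ (f j) < toℕ j × Forces E id (f j) j

-- Orientation of H: edge e = uv oriented from u to v iff
--  (e has a predecessor on its chain, i.e. e is forced (k ≤ e), and the
--   predecessor f e contains u)  or
--  (e has a successor j on its chain, i.e. f j = e for some forced j,
--   and the successor contains v).
-- Edges of H are exactly the edges having a predecessor or successor.
Oriented : ∀ {n m} → Ends n m → ℕ → (Fin m → Fin m) → Fin m → Fin n → Fin n → Set
Oriented {n} {m} E k f e u v =
  SameEnds (E e) (u , v) ×
  ((k ≤ toℕ e × Inc E u (f e)) ⊎
   (∃[ j ] (k ≤ toℕ j × f j ≡ e × Inc E v j)))

Arc : ∀ {n m} → Ends n m → ℕ → (Fin m → Fin m) → Fin n → Fin n → Set
Arc E k f u v = ∃[ e ] Oriented E k f e u v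

DirectedCycle : ∀ {n m} → Ends n m → ℕ → (Fin m → Fin m) → Set
DirectedCycle {n} {m} E k f =
  Σ ℕ λ r → 2 ≤ r × Σ (Fin (Data.Nat.suc r) → Fin n) λ c →
    Injective _≡_ _≡_ c ×
    (∀ (i : Fin r) → Arc E k f (c (inject₁ i)) (c (suc i))) ×
    Arc E k f (c (fromℕ r)) (c zero)

Acyclic : ∀ {n m} → Ends n m → ℕ → (Fin m → Fin m) → Set
Acyclic E k f = ¬ DirectedCycle E k f

-- For a vertex v let latest v be one more than the largest index of an edge at v.
-- Along an arc u → v of H⃗ this potential never decreases.  If the arc comes from
-- an edge e forced by an edge at u, nothing at u is later than e, so latest u is
-- exactly e + 1.  If it comes from an edge e = uv forcing an edge j at v, then j
-- does not contain u, so every edge at u precedes j and latest u < latest v.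
-- Around a directed cycle the potential is therefore constant, so two consecutive
-- arcs u → v → w both come from the latest edge at u, resp. at v; these coincide,
-- forcing w ∈ {u, v}, which is impossible on a cycle of length at least 3.
module Submission where

open import Defs
open import Data.Nat using (ℕ; zero; suc; _≤_; _<_; s≤s; z≤n)
open import Data.Nat.Properties
  using (≤-refl; ≤-trans; ≤-antisym; <-≤-trans; <-irrefl; m<n⇒m<1+n; <⇒≤; ≮⇒≥; suc-injective; _<?_)
open import Data.Fin using (Fin; toℕ; inject₁; fromℕ) renaming (zero to fzero; suc to fsuc)
open import Data.Fin.Properties using (toℕ-injective) renaming (_≟_ to _≟ᶠ_)
open import Data.List using (tabulate)
open import Data.List.Extrema.Nat using (max; xs≤max; max≤v⁺)
open import Data.List.Relation.Unary.All.Properties using (tabulate⁺; tabulate⁻)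
open import Data.Product using (_×_; _,_; proj₁; proj₂; ∃-syntax)
open import Data.Sum using (_⊎_; inj₁; inj₂)
open import Data.Empty using (⊥; ⊥-elim)
open import Function.Base using (id)
open import Relation.Nullary using (¬_; Dec; yes; no)
open import Relation.Nullary.Decidable using (_⊎-dec_)
open import Relation.Binary.PropositionalEquality using (_≡_; _≢_; refl; sym; trans; cong; subst)

module _ {n : ℕ} where

  sameEnds-sym : ∀ {p q : Fin n × Fin n} → SameEnds p q → SameEnds q p
  sameEnds-sym (inj₁ (refl , refl)) = inj₁ (refl , refl)
  sameEnds-sym (inj₂ (refl , refl)) = inj₂ (refl , refl)

  sameEnds-trans : ∀ {p q r : Fin n × Fin n} → SameEnds p q → SameEnds q r → SameEnds p r
  sameEnds-trans (inj₁ (refl , refl)) qr = qr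
  sameEnds-trans (inj₂ (refl , refl)) (inj₁ (refl , refl)) = inj₂ (refl , refl)
  sameEnds-trans (inj₂ (refl , refl)) (inj₂ (refl , refl)) = inj₁ (refl , refl)

  sameEnds-≢ : ∀ {p : Fin n × Fin n} {u v} → proj₁ p ≢ proj₂ p → SameEnds p (u , v) → u ≢ v
  sameEnds-≢ p₁≢p₂ (inj₁ (refl , refl)) = p₁≢p₂
  sameEnds-≢ p₁≢p₂ (inj₂ (refl , refl)) u≡v = p₁≢p₂ (sym u≡v)

module _ {n m : ℕ} (E : Ends n m) where

  sameEnds⇒inc₁ : ∀ {e u v} → SameEnds (E e) (u , v) → Inc E u e
  sameEnds⇒inc₁ (inj₁ (refl , _)) = inj₁ refl
  sameEnds⇒inc₁ (inj₂ (_ , refl)) = inj₂ refl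

  sameEnds⇒inc₂ : ∀ {e u v} → SameEnds (E e) (u , v) → Inc E v e
  sameEnds⇒inc₂ (inj₁ (_ , refl)) = inj₂ refl
  sameEnds⇒inc₂ (inj₂ (refl , _)) = inj₁ refl

  inc⇒sameEnds : ∀ {e u v} → u ≢ v → Inc E u e → Inc E v e → SameEnds (E e) (u , v)
  inc⇒sameEnds u≢v (inj₁ refl) (inj₁ refl) = ⊥-elim (u≢v refl)
  inc⇒sameEnds u≢v (inj₁ refl) (inj₂ refl) = inj₁ (refl , refl)
  inc⇒sameEnds u≢v (inj₂ refl) (inj₁ refl) = inj₂ (refl , refl)
  inc⇒sameEnds u≢v (inj₂ refl) (inj₂ refl) = ⊥-elim (u≢v refl)

  inc-sameEnds⇒≡⊎≡ : ∀ {e u v w} → SameEnds (E e) (u , v) → Inc E w e → w ≡ u ⊎ w ≡ v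
  inc-sameEnds⇒≡⊎≡ (inj₁ (refl , _)) (inj₁ refl) = inj₁ refl
  inc-sameEnds⇒≡⊎≡ (inj₁ (_ , refl)) (inj₂ refl) = inj₂ refl
  inc-sameEnds⇒≡⊎≡ (inj₂ (refl , _)) (inj₁ refl) = inj₂ refl
  inc-sameEnds⇒≡⊎≡ (inj₂ (_ , refl)) (inj₂ refl) = inj₁ refl

  simple⇒edge-unique : IsSimple E → ∀ {e j u v} →
    SameEnds (E e) (u , v) → Inc E u j → Inc E v j → j ≡ e
  simple⇒edge-unique (loopless , parallel-free) {e} {j} uv u∈j v∈j =
    parallel-free j e
      (sameEnds-trans (inc⇒sameEnds (sameEnds-≢ (loopless e) uv) u∈j v∈j) (sameEnds-sym uv))

  inc? : ∀ v e → Dec (Inc E v e)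
  inc? v e = (v ≟ᶠ proj₁ (E e)) ⊎-dec (v ≟ᶠ proj₂ (E e))

  latestWeight : Fin n → Fin m → ℕ
  latestWeight v e with inc? v e
  ... | yes _ = suc (toℕ e)
  ... | no  _ = 0

  latest : Fin n → ℕ
  latest v = max 0 (tabulate (latestWeight v))

  inc⇒<latest : ∀ {v e} → Inc E v e → toℕ e < latest v
  inc⇒<latest {v} {e} v∈e = ≤-trans weight (tabulate⁻ (xs≤max 0 (tabulate (latestWeight v))) e)
    where
    weight : suc (toℕ e) ≤ latestWeight v e
    weight with inc? v e
    ... | yes _   = ≤-refl
    ... | no  v∉e = ⊥-elim (v∉e v∈e)

  latest-lub : ∀ {v b} → (∀ e → Inc E v e → toℕ e < b) → latest v ≤ b
  latest-lub {v} {b} bound = max≤v⁺ z≤n (tabulate⁺ weight)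
    where
    weight : ∀ e → latestWeight v e ≤ b
    weight e with inc? v e
    ... | yes v∈e = bound e v∈e
    ... | no  _   = z≤n

  forcer-neighbour : ∀ {i j v a} → toℕ i < toℕ j → Forces E id i j →
    Inc E v i → Inc E v a → toℕ a < toℕ j ⊎ a ≡ j
  forcer-neighbour {i} {j} {v} {a} i<j (_ , unique) v∈i v∈a with a ≟ᶠ i
  ... | yes refl = inj₁ i<j
  ... | no  a≢i with toℕ a <? toℕ j
  ...   | yes a<j = inj₁ a<j
  ...   | no  a≮j = inj₂ (unique a (≮⇒≥ a≮j) ((λ i≡a → a≢i (sym i≡a)) , v , v∈i , v∈a))

  latest-forcer≤ : ∀ {i j v} → toℕ i < toℕ j → Forces E id i j →
    Inc E v i → latest v ≤ suc (toℕ j)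
  latest-forcer≤ i<j forces v∈i = latest-lub λ a v∈a →
    case (forcer-neighbour i<j forces v∈i v∈a)
    where
    case : ∀ {a j} → toℕ a < toℕ j ⊎ a ≡ j → toℕ a < suc (toℕ j)
    case (inj₁ a<j)  = m<n⇒m<1+n a<j
    case (inj₂ refl) = ≤-refl

  latest-forcer<forced : ∀ {i j v} → toℕ i < toℕ j → Forces E id i j →
    Inc E v i → ¬ Inc E v j → latest v ≤ toℕ j
  latest-forcer<forced {j = j} i<j forces v∈i v∉j = latest-lub λ a v∈a →
    case a v∈a (forcer-neighbour i<j forces v∈i v∈a)
    where
    case : ∀ a → Inc E _ a → toℕ a < toℕ j ⊎ a ≡ j → toℕ a < toℕ j
    case a _   (inj₁ a<j)  = a<j
    case a v∈a (inj₂ refl) = ⊥-elim (v∉j v∈a)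

  module _ (simple : IsSimple E) {k : ℕ} {f : Fin m → Fin m} (valid : ValidForcer E k f) where

    arc⇒latest : ∀ {u v} → Arc E k f u v →
      latest u < latest v ⊎ ∃[ e ] (SameEnds (E e) (u , v) × latest u ≡ suc (toℕ e))
    arc⇒latest (e , uv , inj₁ (k≤e , u∈fe)) =
      inj₂ (e , uv , ≤-antisym (latest-forcer≤ fe<e forces u∈fe) (inc⇒<latest (sameEnds⇒inc₁ uv)))
      where
      fe<e = proj₁ (valid e k≤e)
      forces = proj₂ (valid e k≤e)
    arc⇒latest {u} (e , uv , inj₂ (j , k≤j , refl , v∈j)) =
      inj₁ (<-≤-trans (s≤s (latest-forcer<forced fe<j forces (sameEnds⇒inc₁ uv) u∉j)) (inc⇒<latest v∈j))
      where
      fe<j = proj₁ (valid j k≤j)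
      forces = proj₂ (valid j k≤j)
      u∉j : ¬ Inc E u j
      u∉j u∈j = <-irrefl (cong toℕ (sym (simple⇒edge-unique simple uv u∈j v∈j))) fe<j

    arc⇒latest-≤ : ∀ {u v} → Arc E k f u v → latest u ≤ latest v
    arc⇒latest-≤ arc with arc⇒latest arc
    ... | inj₁ u<v = <⇒≤ u<v
    ... | inj₂ (e , uv , u≡e) = subst (_≤ latest _) (sym u≡e) (inc⇒<latest (sameEnds⇒inc₂ uv))

    non-rising-path⇒return : ∀ {u v w} → Arc E k f u v → Arc E k f v w →
      latest w ≤ latest u → w ≡ u ⊎ w ≡ v
    non-rising-path⇒return uv vw w≤u with arc⇒latest uv | arc⇒latest vw
    ... | inj₁ u<v | _ = ⊥-elim (<-irrefl refl (<-≤-trans u<v (≤-trans (arc⇒latest-≤ vw) w≤u)))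
    ... | inj₂ _ | inj₁ v<w = ⊥-elim (<-irrefl refl (<-≤-trans v<w (≤-trans w≤u (arc⇒latest-≤ uv))))
    ... | inj₂ (e , e-uv , u≡e) | inj₂ (g , g-vw , v≡g) =
      inc-sameEnds⇒≡⊎≡ e-uv (subst (Inc E _) (sym e≡g) (sameEnds⇒inc₂ g-vw))
      where
      u≡v : latest _ ≡ latest _
      u≡v = ≤-antisym (arc⇒latest-≤ uv) (≤-trans (arc⇒latest-≤ vw) w≤u)
      e≡g : e ≡ g
      e≡g = toℕ-injective (suc-injective (trans (sym u≡e) (trans u≡v v≡g)))

monotone-path⇒≤-last : ∀ {A : Set} (g : A → ℕ) r (c : Fin (suc r) → A) →
  (∀ i → g (c (inject₁ i)) ≤ g (c (fsuc i))) → ∀ i → g (c i) ≤ g (c (fromℕ r))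
monotone-path⇒≤-last g zero c mono fzero = ≤-refl
monotone-path⇒≤-last g (suc r) c mono fzero =
  ≤-trans (mono fzero) (monotone-path⇒≤-last g r (λ i → c (fsuc i)) (λ i → mono (fsuc i)) fzero)
monotone-path⇒≤-last g (suc r) c mono (fsuc i) =
  monotone-path⇒≤-last g r (λ i → c (fsuc i)) (λ i → mono (fsuc i)) i

mainTheorem3 : (n m : ℕ) (E : Ends n m) → IsSimple E → Connected E → 2 ≤ n →
    (k : ℕ) → IsZeroForcingNumber E k →
    IsZFOrdering E k (λ j → j) →
    (f : Fin m → Fin m) → ValidForcer E k f →
    Acyclic E k f
mainTheorem3 _ _ _ _ _ _ _ _ _ _ _ (zero , () , _)
mainTheorem3 _ _ _ _ _ _ _ _ _ _ _ (suc zero , s≤s () , _)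
mainTheorem3 _ _ E simple _ _ _ _ _ _ valid (suc (suc r) , _ , c , c-inj , arcs , closing) =
  absurd (non-rising-path⇒return E simple valid (arcs fzero) (arcs (fsuc fzero)) c₂≤c₀)
  where
  c₂ = fsuc (fsuc fzero)
  c₂≤c₀ : latest E (c c₂) ≤ latest E (c fzero)
  c₂≤c₀ = ≤-trans
    (monotone-path⇒≤-last (latest E) (suc (suc r)) c (λ i → arc⇒latest-≤ E simple valid (arcs i)) c₂)
    (arc⇒latest-≤ E simple valid closing)
  absurd : c c₂ ≡ c fzero ⊎ c c₂ ≡ c (fsuc fzero) → ⊥
  absurd (inj₁ eq) with c-inj eq
  ... | ()
  absurd (inj₂ eq) with c-inj eq
  ... | ()
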